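{- Let $n,r,t$ be positive integers with $nr$ even. Let $G=K_{n,\ldots,n,trn}$ be the complete $(r+1)$-partite graph with $r$ parts of size $n$ and one part of size $trn$. Then $\mathrm{def}(G)=0$.
   Context: A complete $(r+1)$-partite graph has its vertex set partitioned into $r+1$ nonempty independent sets with every two vertices in different parts adjacent. For a proper edge-coloring $\alpha$ of a graph $G$ (with positive integer colors) and a vertex $v$, let $S(v,\alpha)$ be the set of colors on edges incident to $v$, and $\mathrm{def}(v,\alpha)=\max S(v,\alpha)-\min S(v,\alpha)-|S(v,\alpha)|+1$. The deficiency of $G$ is $\mathrm{def}(G)=\min_\alpha \sum_{v\in V(G)}\mathrm{def}(v,\alpha)$ over all proper edge-colorings $\alpha$ of $G$; equivalently, the minimum number of pendant edges whose attachment to $G$ yields a graph admitting an interval coloring (a proper edge-coloring with colors $1,\ldots,t$, all used, in which every vertex's color set is an integer interval). In particular $\mathrm{def}(G)=0$ iff $G$ has an interval coloring. -}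

module Defs where

open import Data.Nat using (ℕ; zero; suc; _+_; _*_; _∸_; _≤_; _<ᵇ_; _⊔_; _⊓_; _/_)
open import Data.Nat.Properties using (_≟_)
open import Data.Bool using (if_then_else_)
open import Data.Fin using (Fin; toℕ)
open import Data.List using (List; []; _∷_; map; filter; length; foldr; allFin; deduplicate)
open import Data.Nat.ListAction using (sum)
open import Data.Product using (Σ; _×_)
open import Relation.Nullary using (¬_; Dec; ¬?)
open import Relation.Binary.PropositionalEquality using (_≡_)

record Graph : Set₁ where
  field
    N    : ℕ
    Adj  : Fin N → Fin N → Set
    adj? : (u v : Fin N) → Dec (Adj u v)
open Graph public

-- An edge-coloring assigns a colour to each ordered pair; only adjacent
-- pairs matter, and the colouring must be symmetric on them (edges are unordered).
EdgeColoring : Graph → Set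
EdgeColoring G = Fin (N G) → Fin (N G) → ℕ

record IsProperEdgeColoring (G : Graph) (α : EdgeColoring G) : Set where
  field
    symmetric : ∀ u v → Adj G u v → α u v ≡ α v u
    positive  : ∀ u v → Adj G u v → 1 ≤ α u v
    proper    : ∀ u v w → Adj G u v → Adj G u w → α u v ≡ α u w → v ≡ w

nbrs : (G : Graph) → Fin (N G) → List (Fin (N G))
nbrs G v = filter (adj? G v) (allFin (N G))

S : (G : Graph) → EdgeColoring G → Fin (N G) → List ℕ
S G α v = deduplicate _≟_ (map (α v) (nbrs G v))

maxL : List ℕ → ℕ
maxL = foldr _⊔_ 0

minL : List ℕ → ℕ
minL []       = 0
minL (x ∷ xs) = foldr _⊓_ x xs

-- def(v, α) = max S - min S - |S| + 1  (for nonempty S this is ≥ 0,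
-- so truncated subtraction is exact); 0 for an isolated vertex.
defAux : List ℕ → ℕ
defAux []        = 0
defAux s@(_ ∷ _) = (maxL s + 1) ∸ (minL s + length s)

defv : (G : Graph) → EdgeColoring G → Fin (N G) → ℕ
defv G α v = defAux (S G α v)

totalDef : (G : Graph) → EdgeColoring G → ℕ
totalDef G α = sum (map (defv G α) (allFin (N G)))

IsDeficiency : Graph → ℕ → Set
IsDeficiency G k =
  Σ (EdgeColoring G) (λ α → IsProperEdgeColoring G α × totalDef G α ≡ k)
  × (∀ (α : EdgeColoring G) → IsProperEdgeColoring G α → k ≤ totalDef G α)

completeMultipartite : (N : ℕ) → (Fin N → ℕ) → Graph
completeMultipartite n part = record
  { N    = n
  ; Adj  = λ u v → ¬ (part u ≡ part v)
  ; adj? = λ u v → ¬? (part u ≟ part v)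
  }

-- Part labels for K_{n,...,n,trn}: vertices 0 .. rn-1 are split into parts
-- 0..r-1 of size n (label ⌊i/n⌋); vertices rn .. rn+trn-1 form part r.
partK : (n r t : ℕ) → Fin (r * n + t * r * n) → ℕ
partK zero    r t i = 0
partK (suc m) r t i = if toℕ i <ᵇ r * suc m then toℕ i / suc m else r

K : (n r t : ℕ) → Graph
K n r t = completeMultipartite (r * n + t * r * n) (partK n r t)

module Submission where

-- The r parts of size n span H = K_{n,…,n}, which is ((r−1)n)-regular and, when nr is even,
-- has a 1-factorisation. For r even, blow up the round-robin 1-factorisation of K_r: each vertex
-- becomes n independent copies, and the edge between copies i and j of u and v gets colour
-- c(u,v)·n + (i + j mod n). For r odd, n is even, and one blows up by n/2 the cocktail party
-- graph K_{r×2}, which is K_{2r} minus one colour class of its round robin.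
-- With T = trn, colour the edges of H by T+1, …, T+(r−1)n, and the edge between the i-th vertex
-- of H and the y-th vertex of the big part by 1 + (i + y mod rn) + ⌊y/rn⌋·rn. Every vertex of H
-- then sees exactly the colours 1, …, T+(r−1)n, and every vertex of the big part a block of rn
-- consecutive colours, so all colour sets are intervals.

open import Defs
open import Data.Nat using (ℕ; zero; suc; _+_; _*_; _∸_; _≤_; _<_; z≤n; s≤s; z<s; s<s; _<?_; _/_; _%_; ⌊_/2⌋; pred; NonZero; ≢-nonZero; ≢-nonZero⁻¹)
open import Data.Nat.Properties
open import Data.Nat.DivMod
open import Data.Nat.Divisibility using (_∣_; divides; n∣m*n; ∣m+n∣m⇒∣n)
open import Data.Nat.Solver using (module +-*-Solver)
open import Data.Bool using (if_then_else_)
open import Data.Fin using (Fin; toℕ; fromℕ<)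
open import Data.Fin.Properties using (toℕ-injective; toℕ-fromℕ<; toℕ<n; injective⇒≤)
open import Data.List using (List; []; _∷_; map; length; lookup; allFin)
open import Data.List.Properties using (foldr-preservesᵇ)
open import Data.List.Membership.Propositional using (_∈_)
open import Data.List.Membership.Propositional.Properties using (∈-map⁺; ∈-map⁻; ∈-filter⁺; ∈-filter⁻; ∈-allFin; ∈-deduplicate⁺; ∈-deduplicate⁻)
open import Data.List.Relation.Unary.All using (tabulate)
open import Data.List.Relation.Unary.Any using (here; there; index)
open import Data.List.Relation.Unary.Any.Properties using (lookup-index)
open import Data.Nat.ListAction using (sum)
open import Data.Product using (∃-syntax; _×_; _,_; proj₁; proj₂)
open import Data.Sum using (_⊎_; inj₁; inj₂)
open import Data.Empty using (⊥-elim)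
open import Relation.Nullary using (¬_; does; yes; no)
open import Relation.Nullary.Decidable using (dec-true; dec-false)
open import Relation.Binary.PropositionalEquality
open +-*-Solver

-- Modular arithmetic

-- (a + x) mod d, provided a, x < d.
addMod : ℕ → ℕ → ℕ → ℕ
addMod d a x = if does (a + x <? d) then a + x else a + x ∸ d

addMod-< : ∀ {d a x} → a + x < d → addMod d a x ≡ a + x
addMod-< {d} {a} {x} p rewrite dec-true (a + x <? d) p = refl

addMod-≥ : ∀ {d a x} → d ≤ a + x → addMod d a x + d ≡ a + x
addMod-≥ {d} {a} {x} p rewrite dec-false (a + x <? d) (≤⇒≯ p) = m∸n+n≡m p

addMod-cases : ∀ d a x → (a + x < d × addMod d a x ≡ a + x) ⊎ (d ≤ a + x × addMod d a x + d ≡ a + x)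
addMod-cases d a x with a + x <? d
... | yes p = inj₁ (p , addMod-< {d} {a} {x} p)
... | no ¬p = inj₂ (≮⇒≥ ¬p , addMod-≥ {d} {a} {x} (≮⇒≥ ¬p))

addMod-comm : ∀ d a x → addMod d a x ≡ addMod d x a
addMod-comm d a x rewrite +-comm a x = refl

addMod-bounded : ∀ {d a x} → a < d → x < d → addMod d a x < d
addMod-bounded {d} {a} {x} a<d x<d with addMod-cases d a x
... | inj₁ (p , e) = subst (_< d) (sym e) p
... | inj₂ (_ , e) = +-cancelʳ-< d _ d (subst (_< d + d) (sym e) (+-mono-< a<d x<d))

m+n≢m+o+p : ∀ m o {n p} → n < p → m + n ≢ m + o + p
m+n≢m+o+p m o {n} {p} n<p e =
  <⇒≱ n<p (subst (p ≤_) (sym (+-cancelˡ-≡ m n (o + p) (trans e (+-assoc m o p)))) (m≤n+m p o))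

addMod-injective : ∀ {d} a {x y} → x < d → y < d → addMod d a x ≡ addMod d a y → x ≡ y
addMod-injective {d} a {x} {y} x<d y<d eq with addMod-cases d a x | addMod-cases d a y
... | inj₁ (_ , ex) | inj₁ (_ , ey) = +-cancelˡ-≡ a x y (trans (sym ex) (trans eq ey))
... | inj₂ (_ , ex) | inj₂ (_ , ey) = +-cancelˡ-≡ a x y (trans (sym ex) (trans (cong (_+ d) eq) ey))
... | inj₁ (_ , ex) | inj₂ (_ , ey) = ⊥-elim (m+n≢m+o+p a x y<d (trans (sym ey) (cong (_+ d) (trans (sym eq) ex))))
... | inj₂ (_ , ex) | inj₁ (_ , ey) = ⊥-elim (m+n≢m+o+p a y x<d (trans (sym ex) (cong (_+ d) (trans eq ey))))

addMod-surjective : ∀ {d a c} → a < d → c < d → ∃[ x ] x < d × addMod d a x ≡ c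
addMod-surjective {d} {a} {c} a<d c<d with a ≤? c
... | yes a≤c = c ∸ a , ≤-<-trans (m∸n≤m c a) c<d ,
      trans (addMod-< {d} {a} (subst (_< d) (sym (m+[n∸m]≡n a≤c)) c<d)) (m+[n∸m]≡n a≤c)
... | no a≰c = c + d ∸ a , x<d , +-cancelʳ-≡ d _ _ (trans (addMod-≥ {d} {a} wraps) e)
  where
  e : a + (c + d ∸ a) ≡ c + d
  e = m+[n∸m]≡n (≤-trans (<⇒≤ a<d) (m≤n+m d c))
  wraps : d ≤ a + (c + d ∸ a)
  wraps = subst (d ≤_) (sym e) (m≤n+m d c)
  x<d : c + d ∸ a < d
  x<d = +-cancelˡ-< a _ _ (subst (_< a + d) (sym e) (+-monoˡ-< d (≰⇒> a≰c)))

addMod≡0⇒ : ∀ {d a x} → addMod d a x ≡ 0 → a + x ≡ 0 ⊎ a + x ≡ d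
addMod≡0⇒ {d} {a} {x} z with addMod-cases d a x
... | inj₁ (_ , e) = inj₁ (trans (sym e) z)
... | inj₂ (_ , e) = inj₂ (trans (sym e) (cong (_+ d) z))

addMod-complement : ∀ {d a x} → a + x ≡ d → addMod d a x ≡ 0
addMod-complement {d} {a} {x} s with addMod-cases d a x
... | inj₁ (p , _) = ⊥-elim (<-irrefl s p)
... | inj₂ (_ , e) = +-cancelʳ-≡ d _ 0 (trans e s)

even⊎odd : ∀ n → ∃[ h ] (n ≡ h + h ⊎ n ≡ suc (h + h))
even⊎odd zero = 0 , inj₁ refl
even⊎odd (suc n) with even⊎odd n
... | h , inj₁ e = h , inj₂ (cong suc e)
... | h , inj₂ e = suc h , inj₁ (trans (cong suc e) (cong suc (sym (+-suc h h))))

odd≢even : ∀ a b → suc (a + a) ≢ b + b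
odd≢even a b e = even≢odd b a
  (trans (cong (b +_) (+-identityʳ b)) (trans (sym e) (cong (λ z → suc (a + z)) (sym (+-identityʳ a)))))

+-self-injective : ∀ {u v} → u + u ≡ v + v → u ≡ v
+-self-injective {u} {v} e = trans (n≡⌊n+n/2⌋ u) (trans (cong ⌊_/2⌋ e) (sym (n≡⌊n+n/2⌋ v)))

+-self-cancel-< : ∀ {u v} → u + u < v + v → u < v
+-self-cancel-< {u} {v} p with u <? v
... | yes q = q
... | no ¬q = ⊥-elim (<⇒≱ p (+-mono-≤ (≮⇒≥ ¬q) (≮⇒≥ ¬q)))

module _ (k : ℕ) where

  private
    M = suc (k + k)

    u+k+[u+k]≡u+u+M : ∀ u → suc (u + k + (u + k)) ≡ u + u + M
    u+k+[u+k]≡u+u+M u = solve 2 (λ u k → con 1 :+ (u :+ k :+ (u :+ k)) := u :+ u :+ (con 1 :+ (k :+ k))) refl u k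

  addMod-double-injective : ∀ {u v} → addMod M u u ≡ addMod M v v → u ≡ v
  addMod-double-injective {u} {v} eq with addMod-cases M u u | addMod-cases M v v
  ... | inj₁ (_ , eu) | inj₁ (_ , ev) = +-self-injective (trans (sym eu) (trans eq ev))
  ... | inj₂ (_ , eu) | inj₂ (_ , ev) = +-self-injective (trans (sym eu) (trans (cong (_+ M) eq) ev))
  ... | inj₁ (_ , eu) | inj₂ (_ , ev) = ⊥-elim (odd≢even (u + k) v
    (trans (u+k+[u+k]≡u+u+M u) (trans (cong (_+ M) (trans (sym eu) eq)) ev)))
  ... | inj₂ (_ , eu) | inj₁ (_ , ev) = ⊥-elim (odd≢even (v + k) u
    (trans (u+k+[u+k]≡u+u+M v) (trans (cong (_+ M) (trans (sym ev) (sym eq))) eu)))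

  addMod-double-surjective : ∀ {c} → c < M → ∃[ u ] u < M × addMod M u u ≡ c
  addMod-double-surjective {c} c<M with even⊎odd c
  ... | h , inj₁ refl = h , ≤-<-trans (m≤m+n h h) c<M , addMod-< {M} {h} c<M
  ... | h , inj₂ refl = suc (h + k) , u<M , +-cancelʳ-≡ M _ _ (trans (addMod-≥ {M} {suc (h + k)} wraps) e)
    where
    e : suc (h + k) + suc (h + k) ≡ suc (h + h) + M
    e = solve 2 (λ h k → con 1 :+ (h :+ k) :+ (con 1 :+ (h :+ k)) := con 1 :+ (h :+ h) :+ (con 1 :+ (k :+ k))) refl h k
    wraps : M ≤ suc (h + k) + suc (h + k)
    wraps = subst (M ≤_) (sym e) (m≤n+m M (suc (h + h)))
    u<M : suc (h + k) < M
    u<M = s≤s (+-monoˡ-< k (+-self-cancel-< (≤-pred c<M)))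

[o+m*n]/n≡m : ∀ m n o .{{_ : NonZero n}} → o < n → (o + m * n) / n ≡ m
[o+m*n]/n≡m m n o o<n = begin
  (o + m * n) / n   ≡⟨ +-distrib-/-∣ʳ o (n∣m*n m) ⟩
  o / n + m * n / n ≡⟨ cong₂ _+_ (m<n⇒m/n≡0 o<n) (m*n/n≡m m n) ⟩
  m                 ∎
  where open ≡-Reasoning

[o+m*n]%n≡o : ∀ m n o .{{_ : NonZero n}} → o < n → (o + m * n) % n ≡ o
[o+m*n]%n≡o m n o o<n = trans ([m+kn]%n≡m%n o m n) (m<n⇒m%n≡m o<n)

o+m*n-injective : ∀ {m m′ n o o′} → o < n → o′ < n → o + m * n ≡ o′ + m′ * n → o ≡ o′ × m ≡ m′
o+m*n-injective {m} {m′} {n@(suc _)} {o} {o′} o<n o′<n eq =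
  trans (sym ([o+m*n]%n≡o m n o o<n)) (trans (cong (_% n) eq) ([o+m*n]%n≡o m′ n o′ o′<n)) ,
  trans (sym ([o+m*n]/n≡m m n o o<n)) (trans (cong (_/ n) eq) ([o+m*n]/n≡m m′ n o′ o′<n))

%-/-injective : ∀ {m m′ n} .{{_ : NonZero n}} → m % n ≡ m′ % n → m / n ≡ m′ / n → m ≡ m′
%-/-injective {m} {m′} {n} same% same/ =
  trans (m≡m%n+[m/n]*n m n) (trans (cong₂ (λ x y → x + y * n) same% same/) (sym (m≡m%n+[m/n]*n m′ n)))

o+m*n<p*n : ∀ {m n o p} → o < n → m < p → o + m * n < p * n
o+m*n<p*n {m} {n} {o} {p} o<n m<p = begin-strict
  o + m * n <⟨ +-monoˡ-< (m * n) o<n ⟩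
  n + m * n ≤⟨ *-monoˡ-≤ n m<p ⟩
  p * n     ∎
  where open ≤-Reasoning

-- One-factorisations

record OneFactorisation (V Δ : ℕ) (E : ℕ → ℕ → Set) : Set where
  field
    colour            : ℕ → ℕ → ℕ
    colour-sym        : ∀ {u v} → u < V → v < V → E u v → colour u v ≡ colour v u
    colour-<          : ∀ {u v} → u < V → v < V → E u v → colour u v < Δ
    colour-injective  : ∀ {u v w} → u < V → v < V → w < V → E u v → E u w →
                        colour u v ≡ colour u w → v ≡ w
    colour-surjective : ∀ {u c} → u < V → c < Δ → ∃[ v ] v < V × E u v × colour u v ≡ c
open OneFactorisation public

module _ {V Δ : ℕ} {E : ℕ → ℕ → Set} where

  resp-adjacency : {E′ : ℕ → ℕ → Set} →
    (∀ {u v} → u < V → v < V → E u v → E′ u v) → (∀ {u v} → u < V → v < V → E′ u v → E u v) →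
    OneFactorisation V Δ E → OneFactorisation V Δ E′
  resp-adjacency to from F = record
    { colour            = colour F
    ; colour-sym        = λ p q e → colour-sym F p q (from p q e)
    ; colour-<          = λ p q e → colour-< F p q (from p q e)
    ; colour-injective  = λ p q s e e′ → colour-injective F p q s (from p q e) (from p s e′)
    ; colour-surjective = λ p c<Δ →
        let (v , v<V , e , eq) = colour-surjective F p c<Δ in v , v<V , to p v<V e , eq
    }

  relabel : (F : OneFactorisation V Δ E) (φ ψ : ℕ → ℕ) →
    (∀ {u} → u < V → φ u < V) → (∀ {x} → x < V → ψ x < V) →
    (∀ {u} → u < V → ψ (φ u) ≡ u) → (∀ {x} → x < V → φ (ψ x) ≡ x) →
    OneFactorisation V Δ (λ u v → E (φ u) (φ v))
  relabel F φ ψ φ< ψ< ψφ φψ = record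
    { colour            = λ u v → colour F (φ u) (φ v)
    ; colour-sym        = λ p q → colour-sym F (φ< p) (φ< q)
    ; colour-<          = λ p q → colour-< F (φ< p) (φ< q)
    ; colour-injective  = λ p q s e e′ eq →
        trans (sym (ψφ q)) (trans (cong ψ (colour-injective F (φ< p) (φ< q) (φ< s) e e′ eq)) (ψφ s))
    ; colour-surjective = surjective
    }
    where
    surjective : ∀ {u c} → u < V → c < Δ → ∃[ v ] v < V × E (φ u) (φ v) × colour F (φ u) (φ v) ≡ c
    surjective {u} p c<Δ with colour-surjective F (φ< p) c<Δ
    ... | x , x<V , e , eq = ψ x , ψ< x<V , subst (E (φ u)) (sym (φψ x<V)) e , trans (cong (colour F (φ u)) (φψ x<V)) eq

  blowUp : (F : OneFactorisation V Δ E) (m : ℕ) .{{_ : NonZero m}} →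
    OneFactorisation (V * m) (Δ * m) (λ i j → E (i / m) (j / m))
  blowUp F m = record
    { colour            = blownColour
    ; colour-sym        = λ {i} {j} p q e →
        cong₂ _+_ (addMod-comm m (i % m) (j % m)) (cong (_* m) (colour-sym F (m<n*o⇒m/o<n p) (m<n*o⇒m/o<n q) e))
    ; colour-<          = λ {i} {j} p q e →
        o+m*n<p*n (digit< i j) (colour-< F (m<n*o⇒m/o<n p) (m<n*o⇒m/o<n q) e)
    ; colour-injective  = injective
    ; colour-surjective = surjective
    }
    where
    blownColour : ℕ → ℕ → ℕ
    blownColour i j = addMod m (i % m) (j % m) + colour F (i / m) (j / m) * m

    digit< : ∀ i j → addMod m (i % m) (j % m) < m
    digit< i j = addMod-bounded (m%n<n i m) (m%n<n j m)

    injective : ∀ {i j l} → i < V * m → j < V * m → l < V * m → E (i / m) (j / m) → E (i / m) (l / m) →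
      blownColour i j ≡ blownColour i l → j ≡ l
    injective {i} {j} {l} p q s e e′ eq with o+m*n-injective (digit< i j) (digit< i l) eq
    ... | same-digit , same-colour = %-/-injective (addMod-injective (i % m) (m%n<n j m) (m%n<n l m) same-digit)
      (colour-injective F (m<n*o⇒m/o<n p) (m<n*o⇒m/o<n q) (m<n*o⇒m/o<n s) e e′ same-colour)

    surjective : ∀ {i c} → i < V * m → c < Δ * m → ∃[ j ] j < V * m × E (i / m) (j / m) × blownColour i j ≡ c
    surjective {i} {c} p c<Δm
      with colour-surjective F (m<n*o⇒m/o<n p) (m<n*o⇒m/o<n {c} {Δ} c<Δm)
         | addMod-surjective (m%n<n i m) (m%n<n c m)
    ... | v , v<V , e , eq | x , x<m , eq′ =
      x + v * m , o+m*n<p*n x<m v<V , subst (E (i / m)) (sym ([o+m*n]/n≡m v m x x<m)) e , (begin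
        addMod m (i % m) ((x + v * m) % m) + colour F (i / m) ((x + v * m) / m) * m
          ≡⟨ cong₂ (λ y w → addMod m (i % m) y + colour F (i / m) w * m)
                   ([o+m*n]%n≡o v m x x<m) ([o+m*n]/n≡m v m x x<m) ⟩
        addMod m (i % m) x + colour F (i / m) v * m ≡⟨ cong₂ (λ y w → y + w * m) eq′ eq ⟩
        c % m + (c / m) * m                         ≡⟨ sym (m≡m%n+[m/n]*n c m) ⟩
        c                                           ∎)
      where open ≡-Reasoning

  removeColourZero : (F : OneFactorisation V (suc Δ) E) →
    OneFactorisation V Δ (λ u v → E u v × colour F u v ≢ 0)
  removeColourZero F = record
    { colour            = λ u v → pred (colour F u v)
    ; colour-sym        = λ p q (e , _) → cong pred (colour-sym F p q e)
    ; colour-<          = λ p q (e , ≢0) → pred-mono-< {{≢-nonZero ≢0}} (colour-< F p q e)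
    ; colour-injective  = λ p q s (e , ≢0) (e′ , ≢0′) eq →
        colour-injective F p q s e e′ (pred-injective {{≢-nonZero ≢0}} {{≢-nonZero ≢0′}} eq)
    ; colour-surjective = surjective
    }
    where
    surjective : ∀ {u c} → u < V → c < Δ → ∃[ v ] v < V × (E u v × colour F u v ≢ 0) × pred (colour F u v) ≡ c
    surjective p c<Δ with colour-surjective F p (s≤s c<Δ)
    ... | v , v<V , e , eq = v , v<V , (e , λ z → 1+n≢0 (trans (sym eq) z)) , cong pred eq

-- The round-robin 1-factorisation of K_{M+1}, vertex M playing the role of ∞.
module _ (k : ℕ) where

  private
    M = suc (k + k)

  roundRobinColour : ℕ → ℕ → ℕ
  roundRobinColour u v =
    if does (u <? M) then (if does (v <? M) then addMod M u v else addMod M u u) else addMod M v v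

  private
    colour-<< : ∀ {u v} → u < M → v < M → roundRobinColour u v ≡ addMod M u v
    colour-<< {u} {v} p q rewrite dec-true (u <? M) p | dec-true (v <? M) q = refl

    colour-<∞ : ∀ {u} → u < M → roundRobinColour u M ≡ addMod M u u
    colour-<∞ {u} p rewrite dec-true (u <? M) p | dec-false (M <? M) (<-irrefl refl) = refl

    colour-∞ : ∀ v → roundRobinColour M v ≡ addMod M v v
    colour-∞ v rewrite dec-false (M <? M) (<-irrefl refl) = refl

    double≡0 : ∀ {u} → addMod M u u ≡ 0 → u ≡ 0
    double≡0 {u} z with addMod≡0⇒ {M} {u} {u} z
    ... | inj₁ u+u≡0 = m+n≡0⇒m≡0 u u+u≡0
    ... | inj₂ u+u≡M = ⊥-elim (odd≢even k u (sym u+u≡M))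

  roundRobinColour-sym : ∀ {u v} → u < suc M → v < suc M → roundRobinColour u v ≡ roundRobinColour v u
  roundRobinColour-sym {u} {v} p q with m<1+n⇒m<n∨m≡n p | m<1+n⇒m<n∨m≡n q
  ... | inj₁ u<M | inj₁ v<M = trans (colour-<< u<M v<M) (trans (addMod-comm M u v) (sym (colour-<< v<M u<M)))
  ... | inj₁ u<M | inj₂ refl = trans (colour-<∞ u<M) (sym (colour-∞ u))
  ... | inj₂ refl | inj₁ v<M = trans (colour-∞ v) (sym (colour-<∞ v<M))
  ... | inj₂ refl | inj₂ refl = refl

  roundRobinColour-< : ∀ {u v} → u < suc M → v < suc M → u ≢ v → roundRobinColour u v < M
  roundRobinColour-< {u} {v} p q u≢v with m<1+n⇒m<n∨m≡n p | m<1+n⇒m<n∨m≡n q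
  ... | inj₁ u<M | inj₁ v<M = subst (_< M) (sym (colour-<< u<M v<M)) (addMod-bounded u<M v<M)
  ... | inj₁ u<M | inj₂ refl = subst (_< M) (sym (colour-<∞ u<M)) (addMod-bounded u<M u<M)
  ... | inj₂ refl | inj₁ v<M = subst (_< M) (sym (colour-∞ v)) (addMod-bounded v<M v<M)
  ... | inj₂ refl | inj₂ refl = ⊥-elim (u≢v refl)

  roundRobinColour-injective : ∀ {u v w} → u < suc M → v < suc M → w < suc M → u ≢ v → u ≢ w →
    roundRobinColour u v ≡ roundRobinColour u w → v ≡ w
  roundRobinColour-injective {u} {v} {w} p q s u≢v u≢w eq
    with m<1+n⇒m<n∨m≡n p | m<1+n⇒m<n∨m≡n q | m<1+n⇒m<n∨m≡n s
  ... | inj₁ u<M | inj₁ v<M | inj₁ w<M =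
    addMod-injective u v<M w<M (trans (sym (colour-<< u<M v<M)) (trans eq (colour-<< u<M w<M)))
  ... | inj₁ u<M | inj₁ v<M | inj₂ refl =
    ⊥-elim (u≢v (sym (addMod-injective u v<M u<M (trans (sym (colour-<< u<M v<M)) (trans eq (colour-<∞ u<M))))))
  ... | inj₁ u<M | inj₂ refl | inj₁ w<M =
    ⊥-elim (u≢w (sym (addMod-injective u w<M u<M (trans (sym (colour-<< u<M w<M)) (trans (sym eq) (colour-<∞ u<M))))))
  ... | inj₁ _ | inj₂ refl | inj₂ refl = refl
  ... | inj₂ refl | inj₁ _ | inj₁ _ = addMod-double-injective k (trans (sym (colour-∞ v)) (trans eq (colour-∞ w)))
  ... | inj₂ refl | inj₂ refl | _ = ⊥-elim (u≢v refl)
  ... | inj₂ refl | inj₁ _ | inj₂ refl = ⊥-elim (u≢w refl)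

  roundRobinColour-surjective : ∀ {u c} → u < suc M → c < M →
    ∃[ v ] v < suc M × u ≢ v × roundRobinColour u v ≡ c
  roundRobinColour-surjective {u} {c} p c<M with m<1+n⇒m<n∨m≡n p
  ... | inj₂ refl =
    let (v , v<M , e) = addMod-double-surjective k c<M in
    v , m<n⇒m<1+n v<M , (λ M≡v → <-irrefl (sym M≡v) v<M) , trans (colour-∞ v) e
  ... | inj₁ u<M with addMod-surjective u<M c<M
  ... | v , v<M , e with u ≟ v
  ... | yes refl = M , ≤-refl , <⇒≢ u<M , trans (colour-<∞ u<M) e
  ... | no u≢v = v , m<n⇒m<1+n v<M , u≢v , trans (colour-<< u<M v<M) e

  roundRobinColour≡0⇒ : ∀ {u v} → u < suc M → v < suc M → u ≢ v → roundRobinColour u v ≡ 0 → u + v ≡ M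
  roundRobinColour≡0⇒ {u} {v} p q u≢v z with m<1+n⇒m<n∨m≡n p | m<1+n⇒m<n∨m≡n q
  ... | inj₁ u<M | inj₁ v<M with addMod≡0⇒ {M} {u} {v} (trans (sym (colour-<< u<M v<M)) z)
  ...   | inj₁ u+v≡0 = ⊥-elim (u≢v (trans (m+n≡0⇒m≡0 u u+v≡0) (sym (m+n≡0⇒n≡0 u u+v≡0))))
  ...   | inj₂ u+v≡M = u+v≡M
  roundRobinColour≡0⇒ {u} p q u≢v z | inj₁ u<M | inj₂ refl =
    cong (_+ M) (double≡0 (trans (sym (colour-<∞ u<M)) z))
  roundRobinColour≡0⇒ {_} {v} p q u≢v z | inj₂ refl | inj₁ v<M =
    trans (cong (M +_) (double≡0 (trans (sym (colour-∞ v)) z))) (+-identityʳ M)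
  roundRobinColour≡0⇒ p q u≢v z | inj₂ refl | inj₂ refl = ⊥-elim (u≢v refl)

  roundRobinColour-complement : ∀ {u v} → u < suc M → v < suc M → u + v ≡ M → roundRobinColour u v ≡ 0
  roundRobinColour-complement {u} {v} p q u+v≡M with m<1+n⇒m<n∨m≡n p | m<1+n⇒m<n∨m≡n q
  ... | inj₁ u<M | inj₁ v<M = trans (colour-<< u<M v<M) (addMod-complement {M} {u} u+v≡M)
  ... | inj₁ u<M | inj₂ refl = trans (colour-<∞ u<M) (cong (λ x → addMod M x x) (+-cancelʳ-≡ M u 0 u+v≡M))
  ... | inj₂ refl | inj₁ v<M =
    trans (colour-∞ v) (cong (λ x → addMod M x x) (+-cancelˡ-≡ M v 0 (trans u+v≡M (sym (+-identityʳ M)))))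
  ... | inj₂ refl | inj₂ refl = ⊥-elim (m+1+n≢m M u+v≡M)

  roundRobin : OneFactorisation (suc M) M _≢_
  roundRobin = record
    { colour            = roundRobinColour
    ; colour-sym        = λ p q _ → roundRobinColour-sym p q
    ; colour-<          = roundRobinColour-<
    ; colour-injective  = roundRobinColour-injective
    ; colour-surjective = roundRobinColour-surjective
    }

-- Colour class 0 of the round robin on K_{2r} is the matching {p, M ∸ p} (with 0 matched to
-- ∞ = M); φ renumbers the vertices so that it becomes {2p, 2p + 1}, and removing it leaves
-- the cocktail party graph K_{r×2}.
module _ (R : ℕ) where

  private
    r = suc R
    M = suc (R + R)

    pairEnd : ℕ → ℕ → ℕ
    pairEnd p zero    = p
    pairEnd p (suc _) = M ∸ p

    φ : ℕ → ℕ
    φ b = pairEnd (b / 2) (b % 2)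

    ψ : ℕ → ℕ
    ψ x = if does (x <? r) then x * 2 else suc ((M ∸ x) * 2)

    M≡R+r : M ≡ R + r
    M≡R+r = sym (+-suc R R)

    r*2≡1+M : r * 2 ≡ suc M
    r*2≡1+M = solve 1 (λ R → (con 1 :+ R) :* con 2 := con 1 :+ (con 1 :+ (R :+ R))) refl R

    p<r⇒p≤M : ∀ {p} → p < r → p ≤ M
    p<r⇒p≤M p<r = ≤-trans (≤-pred p<r) (m≤n⇒m≤1+n (m≤m+n R R))

    p<r⇒r≤M∸p : ∀ {p} → p < r → r ≤ M ∸ p
    p<r⇒r≤M∸p {p} p<r = begin
      r         ≡⟨ m+n∸m≡n R r ⟨
      R + r ∸ R ≡⟨ cong (_∸ R) M≡R+r ⟨
      M ∸ R     ≤⟨ ∸-monoʳ-≤ M (≤-pred p<r) ⟩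
      M ∸ p     ∎
      where open ≤-Reasoning

    bit : ∀ b → b % 2 ≡ 0 ⊎ b % 2 ≡ 1
    bit b = n≤1⇒n≡0∨n≡1 (≤-pred (m%n<n b 2))

    half< : ∀ {b} → b < suc M → b / 2 < r
    half< {b} b<1+M = m<n*o⇒m/o<n {b} {r} (subst (b <_) (sym r*2≡1+M) b<1+M)

    φ-even : ∀ b → b % 2 ≡ 0 → φ b ≡ b / 2
    φ-even b e = cong (pairEnd (b / 2)) e

    φ-odd : ∀ b → b % 2 ≡ 1 → φ b ≡ M ∸ b / 2
    φ-odd b e = cong (pairEnd (b / 2)) e

    φ< : ∀ {b} → b < suc M → φ b < suc M
    φ< {b} b<1+M with bit b
    ... | inj₁ e = subst (_< suc M) (sym (φ-even b e)) (s≤s (p<r⇒p≤M (half< b<1+M)))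
    ... | inj₂ e = subst (_< suc M) (sym (φ-odd b e)) (s≤s (m∸n≤m M (b / 2)))

    ψ-< : ∀ {x} → x < r → ψ x ≡ x * 2
    ψ-< {x} x<r rewrite dec-true (x <? r) x<r = refl

    ψ-≥ : ∀ {x} → r ≤ x → ψ x ≡ suc ((M ∸ x) * 2)
    ψ-≥ {x} r≤x rewrite dec-false (x <? r) (≤⇒≯ r≤x) = refl

    ψ< : ∀ {x} → x < suc M → ψ x < suc M
    ψ< {x} x<1+M with x <? r
    ... | yes x<r = subst (_< suc M) (sym (ψ-< x<r)) (subst (x * 2 <_) r*2≡1+M (*-monoˡ-< 2 x<r))
    ... | no x≮r = subst (_< suc M) (sym (ψ-≥ (≮⇒≥ x≮r))) (s≤s (s≤s (begin
      (M ∸ x) * 2 ≤⟨ *-monoˡ-≤ 2 (∸-monoʳ-≤ M (≮⇒≥ x≮r)) ⟩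
      (M ∸ r) * 2 ≡⟨ cong (_* 2) (m+n∸n≡m R R) ⟩
      R * 2       ≡⟨ solve 1 (λ R → R :* con 2 := R :+ R) refl R ⟩
      R + R       ∎)))
      where open ≤-Reasoning

    ψφ : ∀ {b} → b < suc M → ψ (φ b) ≡ b
    ψφ {b} b<1+M with bit b
    ... | inj₁ e = begin
      ψ (φ b)         ≡⟨ cong ψ (φ-even b e) ⟩
      ψ (b / 2)       ≡⟨ ψ-< (half< b<1+M) ⟩
      b / 2 * 2       ≡⟨ cong (_+ b / 2 * 2) e ⟨
      b % 2 + b / 2 * 2 ≡⟨ m≡m%n+[m/n]*n b 2 ⟨
      b               ∎
      where open ≡-Reasoning
    ... | inj₂ e = begin
      ψ (φ b)                         ≡⟨ cong ψ (φ-odd b e) ⟩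
      ψ (M ∸ b / 2)                   ≡⟨ ψ-≥ (p<r⇒r≤M∸p (half< b<1+M)) ⟩
      suc ((M ∸ (M ∸ b / 2)) * 2)     ≡⟨ cong (λ x → suc (x * 2)) (m∸[m∸n]≡n (p<r⇒p≤M (half< b<1+M))) ⟩
      suc (b / 2 * 2)                 ≡⟨ cong (_+ b / 2 * 2) e ⟨
      b % 2 + b / 2 * 2               ≡⟨ m≡m%n+[m/n]*n b 2 ⟨
      b                               ∎
      where open ≡-Reasoning

    φψ : ∀ {x} → x < suc M → φ (ψ x) ≡ x
    φψ {x} x<1+M with x <? r
    ... | yes x<r = begin
      φ (ψ x)                               ≡⟨ cong φ (ψ-< x<r) ⟩
      pairEnd ((x * 2) / 2) ((x * 2) % 2)   ≡⟨ cong₂ pairEnd ([o+m*n]/n≡m x 2 0 z<s) ([o+m*n]%n≡o x 2 0 z<s) ⟩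
      x                                     ∎
      where open ≡-Reasoning
    ... | no x≮r = begin
      φ (ψ x)                       ≡⟨ cong φ (ψ-≥ (≮⇒≥ x≮r)) ⟩
      pairEnd ((1 + y * 2) / 2) ((1 + y * 2) % 2)
                                    ≡⟨ cong₂ pairEnd ([o+m*n]/n≡m y 2 1 (s<s z<s)) ([o+m*n]%n≡o y 2 1 (s<s z<s)) ⟩
      M ∸ (M ∸ x)                   ≡⟨ m∸[m∸n]≡n (≤-pred x<1+M) ⟩
      x                             ∎
      where
      open ≡-Reasoning
      y = M ∸ x

    φ-injective : ∀ {u v} → u < suc M → v < suc M → φ u ≡ φ v → u ≡ v
    φ-injective p q eq = trans (sym (ψφ p)) (trans (cong ψ eq) (ψφ q))

    φ+φ≡M⇒same-pair : ∀ {u v} → u < suc M → v < suc M → φ u + φ v ≡ M → u / 2 ≡ v / 2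
    φ+φ≡M⇒same-pair {u} {v} p q s with bit u | bit v
    ... | inj₁ eu | inj₁ ev = ⊥-elim (<-irrefl s′ (s≤s (+-mono-≤ (≤-pred (half< p)) (≤-pred (half< q)))))
      where
      s′ : u / 2 + v / 2 ≡ M
      s′ = trans (sym (cong₂ _+_ (φ-even u eu) (φ-even v ev))) s
    ... | inj₁ eu | inj₂ ev = +-cancelʳ-≡ (M ∸ v / 2) _ _ (trans s′ (sym (m+[n∸m]≡n (p<r⇒p≤M (half< q)))))
      where
      s′ : u / 2 + (M ∸ v / 2) ≡ M
      s′ = trans (sym (cong₂ _+_ (φ-even u eu) (φ-odd v ev))) s
    ... | inj₂ eu | inj₁ ev = sym (+-cancelˡ-≡ (M ∸ u / 2) _ _ (trans s′ (sym (m∸n+n≡m (p<r⇒p≤M (half< p))))))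
      where
      s′ : (M ∸ u / 2) + v / 2 ≡ M
      s′ = trans (sym (cong₂ _+_ (φ-odd u eu) (φ-even v ev))) s
    ... | inj₂ eu | inj₂ ev = ⊥-elim (<⇒≱ (s<s (+-monoʳ-< R (n<1+n R)))
      (subst (r + r ≤_) s (+-mono-≤ (subst (r ≤_) (sym (φ-odd u eu)) (p<r⇒r≤M∸p (half< p)))
                                     (subst (r ≤_) (sym (φ-odd v ev)) (p<r⇒r≤M∸p (half< q))))))

    same-pair⇒φ+φ≡M : ∀ {u v} → u < suc M → u / 2 ≡ v / 2 → u ≢ v → φ u + φ v ≡ M
    same-pair⇒φ+φ≡M {u} {v} p h u≢v with bit u | bit v
    ... | inj₁ eu | inj₁ ev = ⊥-elim (u≢v (%-/-injective (trans eu (sym ev)) h))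
    ... | inj₂ eu | inj₂ ev = ⊥-elim (u≢v (%-/-injective (trans eu (sym ev)) h))
    ... | inj₁ eu | inj₂ ev = begin
      φ u + φ v           ≡⟨ cong₂ _+_ (φ-even u eu) (φ-odd v ev) ⟩
      u / 2 + (M ∸ v / 2) ≡⟨ cong (λ x → u / 2 + (M ∸ x)) h ⟨
      u / 2 + (M ∸ u / 2) ≡⟨ m+[n∸m]≡n (p<r⇒p≤M (half< p)) ⟩
      M                   ∎
      where open ≡-Reasoning
    ... | inj₂ eu | inj₁ ev = begin
      φ u + φ v           ≡⟨ cong₂ _+_ (φ-odd u eu) (φ-even v ev) ⟩
      (M ∸ u / 2) + v / 2 ≡⟨ cong ((M ∸ u / 2) +_) h ⟨
      (M ∸ u / 2) + u / 2 ≡⟨ m∸n+n≡m (p<r⇒p≤M (half< p)) ⟩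
      M                   ∎
      where open ≡-Reasoning

  cocktailParty : OneFactorisation (suc M) (R + R) (λ u v → u / 2 ≢ v / 2)
  cocktailParty = resp-adjacency to from (relabel (removeColourZero (roundRobin R)) φ ψ φ< ψ< ψφ φψ)
    where
    to : ∀ {u v} → u < suc M → v < suc M → φ u ≢ φ v × roundRobinColour R (φ u) (φ v) ≢ 0 → u / 2 ≢ v / 2
    to {u} {v} p q (φu≢φv , ≢0) h =
      ≢0 (roundRobinColour-complement R (φ< p) (φ< q)
           (same-pair⇒φ+φ≡M {u} {v} p h (λ u≡v → φu≢φv (cong φ u≡v))))
    from : ∀ {u v} → u < suc M → v < suc M → u / 2 ≢ v / 2 →
      φ u ≢ φ v × roundRobinColour R (φ u) (φ v) ≢ 0
    from {u} {v} p q h≢ =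
      φu≢φv , λ z → h≢ (φ+φ≡M⇒same-pair p q (roundRobinColour≡0⇒ R (φ< p) (φ< q) φu≢φv z))
      where
      φu≢φv : φ u ≢ φ v
      φu≢φv eq = h≢ (cong (_/ 2) (φ-injective p q eq))

2∣m*odd⇒2∣m : ∀ m h → 2 ∣ m * suc (h + h) → 2 ∣ m
2∣m*odd⇒2∣m m h 2∣m*odd = ∣m+n∣m⇒∣n (subst (2 ∣_) (trans (*-suc m (h + h)) (+-comm m _)) 2∣m*odd)
  (divides (m * h) (solve 2 (λ m h → m :* (h :+ h) := m :* h :* con 2) refl m h))

multipartite : ∀ n r .{{_ : NonZero n}} .{{_ : NonZero r}} → 2 ∣ n * r →
  OneFactorisation (r * n) (pred r * n) (λ i j → i / n ≢ j / n)
multipartite n r 2∣nr with even⊎odd r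
... | zero , inj₁ refl = ⊥-elim (≢-nonZero⁻¹ 0 refl)
... | suc k , inj₁ refl = subst₂ (λ V Δ → OneFactorisation (V * n) (Δ * n) (λ i j → i / n ≢ j / n))
  (cong suc (sym (+-suc k k))) (sym (+-suc k k)) (blowUp (roundRobin k) n)
... | h , inj₂ refl with 2∣m*odd⇒2∣m n h 2∣nr
...   | divides zero n≡0 = ⊥-elim (≢-nonZero⁻¹ n n≡0)
...   | divides q@(suc _) n≡q*2 =
  subst₂ (λ V Δ → OneFactorisation V Δ (λ i j → i / n ≢ j / n)) vertices degree
    (resp-adjacency (λ _ _ → pairs⇒parts) (λ _ _ → parts⇒pairs) (blowUp (cocktailParty (h + h)) q))
  where
  halve : ∀ i → i / q / 2 ≡ i / n
  halve i = trans (m/n/o≡m/[n*o] i q 2) (/-congʳ (sym n≡q*2))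
  pairs⇒parts : ∀ {i j} → i / q / 2 ≢ j / q / 2 → i / n ≢ j / n
  pairs⇒parts {i} {j} ne eq = ne (trans (halve i) (trans eq (sym (halve j))))
  parts⇒pairs : ∀ {i j} → i / n ≢ j / n → i / q / 2 ≢ j / q / 2
  parts⇒pairs {i} {j} ne eq = ne (trans (sym (halve i)) (trans eq (halve j)))
  vertices : suc (suc ((h + h) + (h + h))) * q ≡ suc (h + h) * n
  vertices = trans
    (solve 2 (λ h q → (con 1 :+ (con 1 :+ ((h :+ h) :+ (h :+ h)))) :* q := (con 1 :+ (h :+ h)) :* (q :* con 2)) refl h q)
                   (cong (suc (h + h) *_) (sym n≡q*2))
  degree : ((h + h) + (h + h)) * q ≡ (h + h) * n
  degree = trans (solve 2 (λ h q → ((h :+ h) :+ (h :+ h)) :* q := (h :+ h) :* (q :* con 2)) refl h q)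
                 (cong ((h + h) *_) (sym n≡q*2))

-- Interval colourings

interval⊆⇒≤length : ∀ (xs : List ℕ) lo len → (∀ {c} → c < len → lo + c ∈ xs) → len ≤ length xs
interval⊆⇒≤length xs lo len covers = injective⇒≤ {f = position} position-injective
  where
  position : Fin len → Fin (length xs)
  position c = index (covers (toℕ<n c))
  position-injective : ∀ {c c′} → position c ≡ position c′ → c ≡ c′
  position-injective {c} {c′} eq = toℕ-injective (+-cancelˡ-≡ lo _ _ (begin
    lo + toℕ c                   ≡⟨ lookup-index (covers (toℕ<n c)) ⟩
    lookup xs (position c)       ≡⟨ cong (lookup xs) eq ⟩
    lookup xs (position c′)      ≡⟨ lookup-index (covers (toℕ<n c′)) ⟨
    lo + toℕ c′                  ∎))
    where open ≡-Reasoning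

defAux-interval : ∀ (xs : List ℕ) lo len → (∀ {x} → x ∈ xs → lo ≤ x × x < lo + len) →
  (∀ {c} → c < len → lo + c ∈ xs) → defAux xs ≡ 0
defAux-interval [] _ _ _ _ = refl
defAux-interval xs@(x ∷ xs′) lo len inside covers = m≤n⇒m∸n≡0 (begin
  maxL xs + 1         ≡⟨ +-comm _ 1 ⟩
  suc (maxL xs)       ≤⟨ max<lo+len ⟩
  lo + len            ≤⟨ +-mono-≤ lo≤min (interval⊆⇒≤length xs lo len covers) ⟩
  minL xs + length xs ∎)
  where
  open ≤-Reasoning
  max<lo+len : maxL xs < lo + len
  max<lo+len = foldr-preservesᵇ ⊔-pres-<m (≤-<-trans z≤n (proj₂ (inside (here refl)))) (tabulate (λ m → proj₂ (inside m)))
  lo≤min : lo ≤ minL xs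
  lo≤min = foldr-preservesᵇ ⊓-glb (proj₁ (inside (here refl))) (tabulate (λ m → proj₁ (inside (there m))))

module _ (G : Graph) (α : EdgeColoring G) (u : Fin (N G)) where

  defv-interval : ∀ lo len → (∀ {w} → Adj G u w → lo ≤ α u w × α u w < lo + len) →
    (∀ {c} → c < len → ∃[ w ] Adj G u w × α u w ≡ lo + c) → defv G α u ≡ 0
  defv-interval lo len inside covers = defAux-interval (S G α u) lo len inside′ covers′
    where
    inside′ : ∀ {x} → x ∈ S G α u → lo ≤ x × x < lo + len
    inside′ m with ∈-map⁻ (α u) (∈-deduplicate⁻ _≟_ (map (α u) (nbrs G u)) m)
    ... | w , w∈nbrs , refl = inside (proj₂ (∈-filter⁻ (adj? G u) {xs = allFin (N G)} w∈nbrs))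
    covers′ : ∀ {c} → c < len → lo + c ∈ S G α u
    covers′ c<len with covers c<len
    ... | w , adj , eq = ∈-deduplicate⁺ _≟_
      (subst (_∈ map (α u) (nbrs G u)) eq (∈-map⁺ (α u) (∈-filter⁺ (adj? G u) (∈-allFin w) adj)))

deficiency-zero : ∀ G (α : EdgeColoring G) → IsProperEdgeColoring G α → (∀ u → defv G α u ≡ 0) →
  IsDeficiency G 0
deficiency-zero G α proper all-zero = (α , proper , sum-zero (allFin (N G))) , λ _ _ → z≤n
  where
  sum-zero : ∀ us → sum (map (defv G α) us) ≡ 0
  sum-zero [] = refl
  sum-zero (u ∷ us) rewrite all-zero u = sum-zero us

-- Joins with an independent set

module _ (X : ℕ) .{{_ : NonZero X}} where

  latin : ℕ → ℕ → ℕ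
  latin i y = addMod X i (y % X) + y / X * X

  module _ {i : ℕ} (i<X : i < X) where

    private
      digit< : ∀ y → addMod X i (y % X) < X
      digit< y = addMod-bounded i<X (m%n<n y X)

    latin-< : ∀ {t y} → y < t * X → latin i y < t * X
    latin-< {t} {y} y<tX = o+m*n<p*n (digit< y) (m<n*o⇒m/o<n {y} {t} y<tX)

    latin-injectiveʳ : ∀ {y y′} → latin i y ≡ latin i y′ → y ≡ y′
    latin-injectiveʳ {y} {y′} eq with o+m*n-injective (digit< y) (digit< y′) eq
    ... | same-digit , same-block = %-/-injective (addMod-injective i (m%n<n y X) (m%n<n y′ X) same-digit) same-block

    latin-surjectiveʳ : ∀ {t c} → c < t * X → ∃[ y ] y < t * X × latin i y ≡ c
    latin-surjectiveʳ {t} {c} c<tX with addMod-surjective i<X (m%n<n c X)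
    ... | x , x<X , eq = x + c / X * X , o+m*n<p*n x<X (m<n*o⇒m/o<n {c} {t} c<tX) , (begin
      addMod X i ((x + c / X * X) % X) + (x + c / X * X) / X * X
        ≡⟨ cong₂ (λ d b → addMod X i d + b * X) ([o+m*n]%n≡o (c / X) X x x<X) ([o+m*n]/n≡m (c / X) X x x<X) ⟩
      addMod X i x + c / X * X ≡⟨ cong (_+ c / X * X) eq ⟩
      c % X + c / X * X        ≡⟨ m≡m%n+[m/n]*n c X ⟨
      c                        ∎)
      where open ≡-Reasoning

  latin-block : ∀ i y → y / X * X ≤ latin i y
  latin-block i y = m≤n+m (y / X * X) (addMod X i (y % X))

  latin-block-< : ∀ {i} y → i < X → latin i y < y / X * X + X
  latin-block-< {i} y i<X = subst (latin i y <_) (+-comm X _) (+-monoˡ-< (y / X * X) (addMod-bounded i<X (m%n<n y X)))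

  latin-injectiveˡ : ∀ {i i′} y → i < X → i′ < X → latin i y ≡ latin i′ y → i ≡ i′
  latin-injectiveˡ {i} {i′} y i<X i′<X eq = addMod-injective (y % X) i<X i′<X
    (trans (addMod-comm X (y % X) i) (trans (+-cancelʳ-≡ (y / X * X) _ _ eq) (addMod-comm X i′ (y % X))))

  latin-surjectiveˡ : ∀ {c} y → c < X → ∃[ i ] i < X × latin i y ≡ y / X * X + c
  latin-surjectiveˡ {c} y c<X with addMod-surjective (m%n<n y X) c<X
  ... | i , i<X , eq = i , i<X , trans (cong (_+ y / X * X) (trans (addMod-comm X i (y % X)) eq)) (+-comm c _)

record IsJoin (G : Graph) (X Y : ℕ) (E : ℕ → ℕ → Set) : Set where
  field
    vertices  : N G ≡ X + Y
    adj-XX⇒   : ∀ {u v} → toℕ u < X → toℕ v < X → Adj G u v → E (toℕ u) (toℕ v)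
    adj-XX⇐   : ∀ {u v} → toℕ u < X → toℕ v < X → E (toℕ u) (toℕ v) → Adj G u v
    adj-XY    : ∀ {u v} → toℕ u < X → X ≤ toℕ v → Adj G u v
    adj-YX    : ∀ {u v} → X ≤ toℕ u → toℕ v < X → Adj G u v
    nonadj-YY : ∀ {u v} → X ≤ toℕ u → X ≤ toℕ v → ¬ Adj G u v

module _ {G : Graph} {X t D : ℕ} {E : ℕ → ℕ → Set} .{{_ : NonZero X}}
         (J : IsJoin G X (t * X) E) (F : OneFactorisation X D E) where

  open IsJoin J

  private
    T = t * X

    joinColour : ℕ → ℕ → ℕ
    joinColour a b =
      if does (a <? X) then (if does (b <? X) then T + colour F a b else latin X a (b ∸ X)) else latin X b (a ∸ X)

    α : EdgeColoring G
    α u v = suc (joinColour (toℕ u) (toℕ v))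

    colour-XX : ∀ {a b} → a < X → b < X → joinColour a b ≡ T + colour F a b
    colour-XX {a} {b} p q rewrite dec-true (a <? X) p | dec-true (b <? X) q = refl

    colour-XY : ∀ {a b} → a < X → X ≤ b → joinColour a b ≡ latin X a (b ∸ X)
    colour-XY {a} {b} p q rewrite dec-true (a <? X) p | dec-false (b <? X) (≤⇒≯ q) = refl

    colour-YX : ∀ {a b} → X ≤ a → joinColour a b ≡ latin X b (a ∸ X)
    colour-YX {a} p rewrite dec-false (a <? X) (≤⇒≯ p) = refl

    data Side (u : Fin (N G)) : Set where
      inX : toℕ u < X → Side u
      inY : X ≤ toℕ u → Side u

    side : ∀ u → Side u
    side u with toℕ u <? X
    ... | yes p = inX p
    ... | no ¬p = inY (≮⇒≥ ¬p)

    y< : ∀ {u} → X ≤ toℕ u → toℕ u ∸ X < T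
    y< {u} p = +-cancelˡ-< X _ _ (subst₂ _<_ (sym (m+[n∸m]≡n p)) vertices (toℕ<n u))

    vertex : ∀ {a} → a < X + T → ∃[ w ] toℕ w ≡ a
    vertex a< = fromℕ< (subst (_ <_) (sym vertices) a<) , toℕ-fromℕ< _

    symmetric : ∀ u v → Adj G u v → α u v ≡ α v u
    symmetric u v adj with side u | side v
    ... | inX p | inX q = cong suc (trans (colour-XX p q)
          (trans (cong (T +_) (colour-sym F p q (adj-XX⇒ p q adj))) (sym (colour-XX q p))))
    ... | inX p | inY q = cong suc (trans (colour-XY p q) (sym (colour-YX q)))
    ... | inY p | inX q = cong suc (trans (colour-YX p) (sym (colour-XY q p)))
    ... | inY p | inY q = ⊥-elim (nonadj-YY p q adj)

    T+c≢latin : ∀ {a c y} → a < X → y < T → T + c ≢ latin X a y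
    T+c≢latin a<X y<T eq = <⇒≱ (latin-< X a<X {t} y<T) (subst (T ≤_) eq (m≤m+n T _))

    proper : ∀ u v w → Adj G u v → Adj G u w → α u v ≡ α u w → v ≡ w
    proper u v w av aw eq′ with suc-injective eq′ | side u | side v | side w
    ... | eq | inX p | inX q | inX s = toℕ-injective (colour-injective F p q s (adj-XX⇒ p q av) (adj-XX⇒ p s aw)
          (+-cancelˡ-≡ T _ _ (trans (sym (colour-XX p q)) (trans eq (colour-XX p s)))))
    ... | eq | inX p | inX q | inY s = ⊥-elim (T+c≢latin p (y< s)
          (trans (sym (colour-XX p q)) (trans eq (colour-XY p s))))
    ... | eq | inX p | inY q | inX s = ⊥-elim (T+c≢latin p (y< q)
          (trans (sym (colour-XX p s)) (trans (sym eq) (colour-XY p q))))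
    ... | eq | inX p | inY q | inY s = toℕ-injective (begin
          toℕ v           ≡⟨ m∸n+n≡m q ⟨
          toℕ v ∸ X + X   ≡⟨ cong (_+ X) (latin-injectiveʳ X p (trans (sym (colour-XY p q)) (trans eq (colour-XY p s)))) ⟩
          toℕ w ∸ X + X   ≡⟨ m∸n+n≡m s ⟩
          toℕ w           ∎)
      where open ≡-Reasoning
    ... | eq | inY p | inX q | inX s =
          toℕ-injective (latin-injectiveˡ X (toℕ u ∸ X) q s (trans (sym (colour-YX p)) (trans eq (colour-YX p))))
    ... | _ | inY p | inY q | _ = ⊥-elim (nonadj-YY p q av)
    ... | _ | inY p | inX _ | inY s = ⊥-elim (nonadj-YY p s aw)

    defv-X : ∀ u → toℕ u < X → defv G α u ≡ 0
    defv-X u p = defv-interval G α u 1 (T + D) inside covers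
      where
      open ≡-Reasoning
      a = toℕ u
      inside : ∀ {w} → Adj G u w → 1 ≤ α u w × α u w < 1 + (T + D)
      inside {w} adj with side w
      ... | inX q = s≤s z≤n ,
        s≤s (subst (_< T + D) (sym (colour-XX p q)) (+-monoʳ-< T (colour-< F p q (adj-XX⇒ p q adj))))
      ... | inY q = s≤s z≤n ,
        s≤s (subst (_< T + D) (sym (colour-XY p q)) (<-≤-trans (latin-< X p {t} (y< q)) (m≤m+n T D)))
      covers : ∀ {c} → c < T + D → ∃[ w ] Adj G u w × α u w ≡ 1 + c
      covers {c} c<T+D with c <? T
      ... | yes c<T =
        let (y , y<T , eq) = latin-surjectiveʳ X p {t} c<T
            (w , w≡X+y) = vertex (+-monoʳ-< X y<T)
            X≤w = subst (X ≤_) (sym w≡X+y) (m≤m+n X y)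
        in w , adj-XY p X≤w , cong suc (begin
             joinColour a (toℕ w)  ≡⟨ colour-XY p X≤w ⟩
             latin X a (toℕ w ∸ X) ≡⟨ cong (λ b → latin X a (b ∸ X)) w≡X+y ⟩
             latin X a (X + y ∸ X) ≡⟨ cong (latin X a) (m+n∸m≡n X y) ⟩
             latin X a y           ≡⟨ eq ⟩
             c                     ∎)
      ... | no c≮T =
        let T≤c = ≮⇒≥ c≮T
            (b , b<X , e , eq) = colour-surjective F p (+-cancelˡ-< T _ _ (subst (_< T + D) (sym (m+[n∸m]≡n T≤c)) c<T+D))
            (w , w≡b) = vertex (<-≤-trans b<X (m≤m+n X T))
            w<X = subst (_< X) (sym w≡b) b<X
        in w , adj-XX⇐ p w<X (subst (E a) (sym w≡b) e) , cong suc (begin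
             joinColour a (toℕ w)   ≡⟨ colour-XX p w<X ⟩
             T + colour F a (toℕ w) ≡⟨ cong (λ b → T + colour F a b) w≡b ⟩
             T + colour F a b       ≡⟨ cong (T +_) eq ⟩
             T + (c ∸ T)            ≡⟨ m+[n∸m]≡n T≤c ⟩
             c                      ∎)

    defv-Y : ∀ u → X ≤ toℕ u → defv G α u ≡ 0
    defv-Y u p = defv-interval G α u (suc (y / X * X)) X inside covers
      where
      y = toℕ u ∸ X
      inside : ∀ {w} → Adj G u w → suc (y / X * X) ≤ α u w × α u w < suc (y / X * X) + X
      inside {w} adj with side w
      ... | inX q = subst (λ c → suc (y / X * X) ≤ suc c × suc c < suc (y / X * X) + X) (sym (colour-YX p))
                      (s≤s (latin-block X (toℕ w) y) , s≤s (latin-block-< X y q))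
      ... | inY q = ⊥-elim (nonadj-YY p q adj)
      covers : ∀ {c} → c < X → ∃[ w ] Adj G u w × α u w ≡ suc (y / X * X) + c
      covers c<X =
        let (i , i<X , eq) = latin-surjectiveˡ X y c<X
            (w , w≡i) = vertex (<-≤-trans i<X (m≤m+n X T))
            w<X = subst (_< X) (sym w≡i) i<X
        in w , adj-YX p w<X , cong suc (trans (colour-YX p) (trans (cong (λ i → latin X i y) w≡i) eq))

  join-deficiency-zero : IsDeficiency G 0
  join-deficiency-zero = deficiency-zero G α proper-colouring defv-zero
    where
    proper-colouring : IsProperEdgeColoring G α
    proper-colouring = record { symmetric = symmetric ; positive = λ _ _ _ → s≤s z≤n ; proper = proper }
    defv-zero : ∀ u → defv G α u ≡ 0
    defv-zero u with side u
    ... | inX p = defv-X u p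
    ... | inY p = defv-Y u p

-- The graph K_{n,…,n,trn}

module _ (m r t : ℕ) where

  private
    n = suc m

  partK-X : ∀ i → toℕ i < r * n → partK n r t i ≡ toℕ i / n
  partK-X i p rewrite dec-true (toℕ i <? r * n) p = refl

  partK-Y : ∀ i → r * n ≤ toℕ i → partK n r t i ≡ r
  partK-Y i p rewrite dec-false (toℕ i <? r * n) (≤⇒≯ p) = refl

  K-isJoin : IsJoin (K n r t) (r * n) (t * (r * n)) (λ i j → i / n ≢ j / n)
  K-isJoin = record
    { vertices  = cong (r * n +_) (*-assoc t r n)
    ; adj-XX⇒   = λ {u} {v} p q adj eq → adj (trans (partK-X u p) (trans eq (sym (partK-X v q))))
    ; adj-XX⇐   = λ {u} {v} p q ne eq → ne (trans (sym (partK-X u p)) (trans eq (partK-X v q)))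
    ; adj-XY    = λ {u} {v} p q eq → <-irrefl (trans (sym (partK-X u p)) (trans eq (partK-Y v q))) (m<n*o⇒m/o<n p)
    ; adj-YX    = λ {u} {v} p q eq → <-irrefl (trans (sym (partK-X v q)) (trans (sym eq) (partK-Y u p))) (m<n*o⇒m/o<n q)
    ; nonadj-YY = λ {u} {v} p q adj → adj (trans (partK-Y u p) (sym (partK-Y v q)))
    }

theorem8 : (n r t : ℕ) → 1 ≤ n → 1 ≤ r → 1 ≤ t → 2 ∣ n * r →
    IsDeficiency (K n r t) 0
theorem8 zero    _       _ ()  _  _ _
theorem8 (suc _) zero    _ _   () _ _
theorem8 (suc m) (suc r) t _   _  _ 2∣nr =
  join-deficiency-zero {t = t} (K-isJoin m (suc r) t) (multipartite (suc m) (suc r) 2∣nr)
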